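{- Let $q$ be a prime power with $q\equiv 1\pmod 4$ and $q\not\equiv 1\pmod 3$, and let $x\in\mathbb{F}_{q^3}$ satisfy $\mathrm{T}(x)=\mathrm{T}(x^2)=0$. (i) If $q\equiv 5\pmod 6$, then $x=0$. (ii) If $q=3^h$, then $x\in\mathbb{F}_q$.
   Context: $\mathrm{T}(x)=x+x^q+x^{q^2}$ is the trace from $\mathbb{F}_{q^3}$ to $\mathbb{F}_q$. -}

module Defs where

open import Level using (Level; _⊔_; suc)
open import Data.Nat using (ℕ; _<_; _^_)
open import Data.Nat.Primality using (Prime)
open import Data.Fin using (Fin)
open import Data.Product using (Σ; ∃; _×_)
open import Relation.Binary.PropositionalEquality using (_≡_)
import Relation.Binary.PropositionalEquality as P
open import Relation.Nullary using (¬_)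
open import Function.Bundles using (Bijection)
open import Algebra.Bundles using (CommutativeRing)
import Algebra.Bundles
import Algebra.Definitions.RawSemiring as RS
open import Algebra.Morphism.Structures using (IsRingHomomorphism)

IsPrimePower : ℕ → Set
IsPrimePower q = Σ ℕ λ p → Σ ℕ λ k → Prime p × 0 < k × q ≡ p ^ k

IsField : ∀ {c ℓ} → CommutativeRing c ℓ → Set (c ⊔ ℓ)
IsField R = ¬ (1# ≈ 0#) × (∀ x → ¬ (x ≈ 0#) → ∃ λ y → x * y ≈ 1#)
  where open CommutativeRing R

record FiniteField (c ℓ : Level) (n : ℕ) : Set (suc (c ⊔ ℓ)) where
  field
    cring   : CommutativeRing c ℓ
    isField : IsField cring
    card    : Bijection (P.setoid (Fin n)) (CommutativeRing.setoid cring)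
  open CommutativeRing cring public

pow : ∀ {c ℓ} (R : CommutativeRing c ℓ) → CommutativeRing.Carrier R → ℕ → CommutativeRing.Carrier R
pow R = RS._^_ (Algebra.Bundles.RawRing.rawSemiring (CommutativeRing.rawRing R))

Tr : ∀ {c ℓ} (q : ℕ) (L : FiniteField c ℓ (q ^ 3)) → FiniteField.Carrier L → FiniteField.Carrier L
Tr q L x = x + pow cring x q + pow cring x (q ^ 2)
  where open FiniteField L

IsFieldEmbedding : ∀ {c ℓ c' ℓ'} {m n : ℕ} (K : FiniteField c ℓ m) (L : FiniteField c' ℓ' n)
                   → (FiniteField.Carrier K → FiniteField.Carrier L) → Set (c ⊔ ℓ ⊔ ℓ')
IsFieldEmbedding K L f = IsRingHomomorphism (FiniteField.rawRing K) (FiniteField.rawRing L) f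

module Submission where

-- Write a = x, b = x^q, c = x^(q²) for the conjugates of x. Since
-- (x²)^q = (x^q)², the hypotheses T(x) = T(x²) = 0 say a + b + c = 0 and
-- a² + b² + c² = 0, and in any commutative ring these imply 2 Q(a, b) = 0 for
-- the quadratic form Q(a, b) = a² + ab + b².
-- (i)  If q ≡ 5 (mod 6), the order N = q³ of L is ≡ 1 (mod 2) and ≡ 2 (mod 3),
--      so 2 ≠ 0 and 3 ≠ 0 in L. Then Q(a, b) = 0, so a³ = b³; cubing is
--      injective on a field of order ≡ 2 (mod 3) by Fermat's little theorem,
--      so a = b, and 3a² = Q(a, a) = 0 gives x = 0.
-- (ii) If q = 3^h, L has characteristic 3, where Q(a, b) = (a + 2b)²; so
--      x^q = x. If x were not in the image of the embedded field K of order q,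
--      then x together with the q elements of ι(K) (fixed by Fermat in K)
--      would be q + 1 distinct roots of the monic polynomial X^q - X.

open import Defs
open import Data.Nat using (ℕ; _^_; _%_)
open import Data.Product using (∃; _×_)
open import Relation.Binary.PropositionalEquality using (_≡_; _≢_)
open import Level using (Level)

open import Algebra.Bundles using (CommutativeRing; CommutativeMonoid)
open import Algebra.Morphism.Structures using (IsRingHomomorphism)
import Algebra.Properties.CommutativeMonoid.Sum as MonoidSum
open import Data.Empty using (⊥; ⊥-elim)
open import Data.Fin using (Fin; zero; suc; punchIn)
open import Data.Fin.Properties using (suc-injective; punchInᵢ≢i; 0≢1+n) renaming (_≟_ to _≟ᶠ_; any? to anyᶠ?)
open import Data.Fin.Permutation using (Permutation; permutation)
open import Data.Nat as ℕ using (zero; suc; NonZero)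
open import Data.Nat.DivMod using (m≡m%n+[m/n]*n; %-distribˡ-*; m%n%n≡m%n; m∣n⇒o%n%m≡o%m)
open import Data.Nat.Divisibility using (_∣_; divides)
import Data.Nat.Properties as ℕₚ
open import Data.Nat.Solver using (module +-*-Solver)
open import Data.Product using (Σ; _,_; proj₁; proj₂)
open import Data.Vec using (Vec; []; _∷_; replicate)
open import Function.Bundles using (Bijection)
open import Relation.Nullary using (¬_; Dec; yes; no)
import Relation.Binary.PropositionalEquality as ≡

pow-mod : ∀ m n d .{{_ : NonZero d}} → (m ^ n) % d ≡ ((m % d) ^ n) % d
pow-mod m zero    d = ≡.refl
pow-mod m (suc n) d = begin
  (m ℕ.* m ^ n) % d                          ≡⟨ %-distribˡ-* m (m ^ n) d ⟩
  ((m % d) ℕ.* ((m ^ n) % d)) % d            ≡⟨ ≡.cong (λ e → ((m % d) ℕ.* e) % d) (pow-mod m n d) ⟩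
  ((m % d) ℕ.* (((m % d) ^ n) % d)) % d      ≡⟨ ≡.cong (λ e → (e ℕ.* (((m % d) ^ n) % d)) % d) (≡.sym (m%n%n≡m%n m d)) ⟩
  ((m % d % d) ℕ.* (((m % d) ^ n) % d)) % d  ≡⟨ ≡.sym (%-distribˡ-* (m % d) ((m % d) ^ n) d) ⟩
  ((m % d) ^ suc n) % d                      ∎
  where open ≡.≡-Reasoning

cube-residues : ∀ q → q % 6 ≡ 5 → (q ^ 3) % 2 ≡ 1 × (q ^ 3) % 3 ≡ 2
cube-residues q q≡5 = residue 2 (divides 3 ≡.refl) , residue 3 (divides 2 ≡.refl)
  where
  q³≡5 : (q ^ 3) % 6 ≡ 5
  q³≡5 = ≡.trans (pow-mod q 3 6) (≡.cong (λ r → (r ^ 3) % 6) q≡5)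
  residue : ∀ d .{{_ : NonZero d}} → d ∣ 6 → (q ^ 3) % d ≡ 5 % d
  residue d d∣6 = ≡.trans (≡.sym (m∣n⇒o%n%m≡o%m d 6 (q ^ 3) d∣6)) (≡.cong (_% d) q³≡5)

-- The exponent identity behind unique cube roots in a field of order 2 + 3k.
cube-exponent : ∀ k → 3 ℕ.* (1 ℕ.+ 2 ℕ.* k) ≡ (2 ℕ.+ k ℕ.* 3) ℕ.+ (1 ℕ.+ k ℕ.* 3)
cube-exponent = solve 1 (λ k → con 3 :* (con 1 :+ con 2 :* k) := (con 2 :+ k :* con 3) :+ (con 1 :+ k :* con 3)) ≡.refl
  where open +-*-Solver

-- Identities in a commutative ring R. They are proved with the library's ring
-- solver with natural-number coefficients, hence stated without subtraction.
module RingFacts {c ℓ} (R : CommutativeRing c ℓ) where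
  open CommutativeRing R
  open import Relation.Binary.Reasoning.Setoid setoid
  open import Algebra.Solver.Ring.NaturalCoefficients.Default commutativeSemiring
    using (solve; _:=_; _:+_; _:*_; con)
  open import Algebra.Properties.Semiring.Mult semiring
    using (×-homo-+; ×1-homo-*) renaming (_×_ to _×ₙ_)

  ⟦_⟧ : ℕ → Carrier
  ⟦ n ⟧ = n ×ₙ 1#

  ⟦⟧-^ : ∀ m n → ⟦ m ^ n ⟧ ≈ pow R ⟦ m ⟧ n
  ⟦⟧-^ m zero    = +-identityʳ 1#
  ⟦⟧-^ m (suc n) = trans (×1-homo-* m (m ^ n)) (*-congˡ (⟦⟧-^ m n))

  reduce-mod : ∀ m n .{{_ : NonZero m}} → ⟦ m ⟧ ≈ 0# → ⟦ n ⟧ ≈ ⟦ n % m ⟧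
  reduce-mod m n m≈0 = begin
    ⟦ n ⟧                                 ≡⟨ ≡.cong ⟦_⟧ (m≡m%n+[m/n]*n n m) ⟩
    ⟦ n % m ℕ.+ n ℕ./ m ℕ.* m ⟧           ≈⟨ ×-homo-+ 1# (n % m) (n ℕ./ m ℕ.* m) ⟩
    ⟦ n % m ⟧ + ⟦ n ℕ./ m ℕ.* m ⟧         ≈⟨ +-congˡ (×1-homo-* (n ℕ./ m) m) ⟩
    ⟦ n % m ⟧ + ⟦ n ℕ./ m ⟧ * ⟦ m ⟧       ≈⟨ +-congˡ (trans (*-congˡ m≈0) (zeroʳ _)) ⟩
    ⟦ n % m ⟧ + 0#                        ≈⟨ +-identityʳ _ ⟩
    ⟦ n % m ⟧                             ∎

  double : ∀ x → ⟦ 2 ⟧ * x ≈ x + x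
  double = solve 1 (λ x → (con 1 :+ (con 1 :+ con 0)) :* x := x :+ x) refl

  triple : ∀ x → ⟦ 3 ⟧ * x ≈ x + x + x
  triple = solve 1 (λ x → (con 1 :+ (con 1 :+ (con 1 :+ con 0))) :* x := x :+ x :+ x) refl

  Q : Carrier → Carrier → Carrier
  Q a b = a * a + a * b + b * b

  -- Vanishing first and second power sums of a, b, c force 2 Q(a, b) = 0,
  -- because 2 Q(a,b) + (a+b+c) c = (a² + b² + c²) + (a+b+c)(a+b).
  power-sums : ∀ {a b c} → a + b + c ≈ 0# → a * a + b * b + c * c ≈ 0# → Q a b + Q a b ≈ 0#
  power-sums {a} {b} {c} p₁ p₂ = begin
    Q a b + Q a b                               ≈⟨ sym (+-identityʳ _) ⟩
    Q a b + Q a b + 0#                          ≈⟨ +-congˡ (sym (trans (*-congʳ p₁) (zeroˡ c))) ⟩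
    Q a b + Q a b + (a + b + c) * c             ≈⟨ identity a b c ⟩
    a * a + b * b + c * c + (a + b + c) * (a + b) ≈⟨ +-cong p₂ (trans (*-congʳ p₁) (zeroˡ _)) ⟩
    0# + 0#                                     ≈⟨ +-identityʳ 0# ⟩
    0#                                          ∎
    where
    identity : ∀ a b c → Q a b + Q a b + (a + b + c) * c ≈ a * a + b * b + c * c + (a + b + c) * (a + b)
    identity = solve 3 (λ a b c →
        (a :* a :+ a :* b :+ b :* b) :+ (a :* a :+ a :* b :+ b :* b) :+ (a :+ b :+ c) :* c
      := a :* a :+ b :* b :+ c :* c :+ (a :+ b :+ c) :* (a :+ b)) refl

  -- Since (a - b) Q(a, b) = a³ - b³, a root of Q gives equal cubes.
  equal-cubes : ∀ {a b} → Q a b ≈ 0# → a * a * a ≈ b * b * b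
  equal-cubes {a} {b} Q≈0 = begin
    a * a * a              ≈⟨ sym (+-identityˡ _) ⟩
    0# + a * a * a         ≈⟨ +-congʳ (sym (trans (*-congˡ Q≈0) (zeroʳ b))) ⟩
    b * Q a b + a * a * a  ≈⟨ sym (cube-difference a b) ⟩
    a * Q a b + b * b * b  ≈⟨ +-congʳ (trans (*-congˡ Q≈0) (zeroʳ a)) ⟩
    0# + b * b * b         ≈⟨ +-identityˡ _ ⟩
    b * b * b              ∎
    where
    cube-difference : ∀ a b → a * Q a b + b * b * b ≈ b * Q a b + a * a * a
    cube-difference = solve 2 (λ a b →
        a :* (a :* a :+ a :* b :+ b :* b) :+ b :* b :* b
      := b :* (a :* a :+ a :* b :+ b :* b) :+ a :* a :* a) refl

  -- (a + 2b)² = Q(a, b) + 3(ab + b²), so (a + 2b)² = Q(a, b) in characteristic 3.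
  shifted-square : ∀ a b → (a + b + b) * (a + b + b) ≈ Q a b + (a * b + b * b + (a * b + b * b) + (a * b + b * b))
  shifted-square = solve 2 (λ a b →
      (a :+ b :+ b) :* (a :+ b :+ b)
    := (a :* a :+ a :* b :+ b :* b) :+ (a :* b :+ b :* b :+ (a :* b :+ b :* b) :+ (a :* b :+ b :* b))) refl

  cube-as-pow : ∀ x → pow R x 3 ≈ x * x * x
  cube-as-pow x = trans (*-congˡ (*-congˡ (*-identityʳ x))) (sym (*-assoc x x x))

module _ {a ℓa} (M : CommutativeMonoid a ℓa) where
  open CommutativeMonoid M
  open MonoidSum M using (sum; sum-remove; sum-cong-≋; sum-replicate-zero)

  sum-single : ∀ {n} (f : Fin n → Carrier) (j : Fin n) → (∀ i → i ≢ j → f i ≈ ε) → sum f ≈ f j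
  sum-single {suc n} f j off = trans (sum-remove {i = j} f) (trans (∙-congˡ rest≈ε) (identityʳ (f j)))
    where
    rest≈ε : sum (λ i → f (punchIn j i)) ≈ ε
    rest≈ε = trans (sum-cong-≋ (λ i → off _ (punchInᵢ≢i j i))) (sum-replicate-zero n)

module FiniteFieldFacts {c ℓ N} (F : FiniteField c ℓ N) where
  open FiniteField F hiding (zero)
  open RingFacts cring public
  open import Relation.Binary.Reasoning.Setoid setoid
  open import Algebra.Solver.Ring.NaturalCoefficients.Default commutativeSemiring
    using (solve; _:=_; _:+_; _:*_; con)
  open import Algebra.Properties.Group +-group using (identityʳ-unique)
  open import Algebra.Properties.Semiring.Exp semiring using (^-congˡ; ^-homo-*; ^-assocʳ)
  private module Enumeration = Bijection card

  infixr 8 _↑_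
  _↑_ : Carrier → ℕ → Carrier
  _↑_ = pow cring

  element : Fin N → Carrier
  element = Enumeration.to

  index : Carrier → Fin N
  index y = proj₁ (Enumeration.surjective y)

  element-index : ∀ y → element (index y) ≈ y
  element-index y = proj₂ (Enumeration.surjective y) ≡.refl

  index-cong : ∀ {y z} → y ≈ z → index y ≡ index z
  index-cong {y} {z} y≈z = Enumeration.injective (trans (element-index y) (trans y≈z (sym (element-index z))))

  index-element : ∀ i → index (element i) ≡ i
  index-element i = Enumeration.injective (element-index (element i))

  element-injective : ∀ {i j} → element i ≈ element j → i ≡ j
  element-injective {i} {j} eq = ≡.trans (≡.sym (index-element i)) (≡.trans (index-cong eq) (index-element j))

  infix 4 _≟_
  _≟_ : ∀ x y → Dec (x ≈ y)
  x ≟ y with index x ≟ᶠ index y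
  ... | yes eq  = yes (trans (sym (element-index x)) (trans (reflexive (≡.cong element eq)) (element-index y)))
  ... | no  neq = no (λ x≈y → neq (index-cong x≈y))

  1≉0 : ¬ 1# ≈ 0#
  1≉0 = proj₁ isField

  inverse : ∀ x → ¬ x ≈ 0# → ∃ λ y → x * y ≈ 1#
  inverse = proj₂ isField

  cancelˡ : ∀ {x y z} → ¬ x ≈ 0# → x * y ≈ x * z → y ≈ z
  cancelˡ {x} {y} {z} x≉0 xy≈xz with inverse x x≉0
  ... | w , xw≈1 = begin
    y            ≈⟨ sym (*-identityˡ y) ⟩
    1# * y       ≈⟨ *-congʳ (sym xw≈1) ⟩
    x * w * y    ≈⟨ regroup x w y ⟩
    w * (x * y)  ≈⟨ *-congˡ xy≈xz ⟩
    w * (x * z)  ≈⟨ sym (regroup x w z) ⟩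
    x * w * z    ≈⟨ *-congʳ xw≈1 ⟩
    1# * z       ≈⟨ *-identityˡ z ⟩
    z            ∎
    where
    regroup : ∀ x w y → x * w * y ≈ w * (x * y)
    regroup = solve 3 (λ x w y → x :* w :* y := w :* (x :* y)) refl

  zero-product : ∀ {x y} → ¬ x ≈ 0# → x * y ≈ 0# → y ≈ 0#
  zero-product {x} x≉0 xy≈0 = cancelˡ x≉0 (trans xy≈0 (sym (zeroʳ x)))

  pow-zero : ∀ {x} n → x ↑ n ≈ 0# → x ≈ 0#
  pow-zero zero 1≈0 = ⊥-elim (1≉0 1≈0)
  pow-zero {x} (suc n) x·xⁿ≈0 with x ≟ 0#
  ... | yes x≈0 = x≈0
  ... | no  x≉0 = pow-zero n (zero-product x≉0 x·xⁿ≈0)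

  square-zero : ∀ {x} → x * x ≈ 0# → x ≈ 0#
  square-zero {x} xx≈0 with x ≟ 0#
  ... | yes x≈0 = x≈0
  ... | no  x≉0 = zero-product x≉0 xx≈0

  module _ {a ℓa} (M : CommutativeMonoid a ℓa) where
    private module M = CommutativeMonoid M
    open MonoidSum M using (sum; sum-permute; sum-cong-≋)

    sum-reindex : (f : Carrier → M.Carrier) → (∀ {y z} → y ≈ z → f y M.≈ f z)
                  → (φ ψ : Carrier → Carrier) → (∀ {y z} → y ≈ z → φ y ≈ φ z) → (∀ {y z} → y ≈ z → ψ y ≈ ψ z)
                  → (∀ y → ψ (φ y) ≈ y) → (∀ y → φ (ψ y) ≈ y)
                  → sum (λ i → f (φ (element i))) M.≈ sum (λ i → f (element i))
    sum-reindex f f-cong φ ψ φ-cong ψ-cong ψφ φψ =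
      M.sym (M.trans (sum-permute (λ i → f (element i)) π) (sum-cong-≋ {N} (λ i → f-cong (element-index (φ (element i))))))
      where
      π : Permutation N N
      π = permutation (λ i → index (φ (element i))) (λ i → index (ψ (element i)))
        (λ i → ≡.trans (index-cong (trans (φ-cong (element-index _)) (φψ (element i)))) (index-element i))
        (λ i → ≡.trans (index-cong (trans (ψ-cong (element-index _)) (ψφ (element i)))) (index-element i))

  -- The order of F vanishes in F: translating every element by 1 does not
  -- change the sum S of all elements, so S + N = S.
  order-vanishes : ⟦ N ⟧ ≈ 0#
  order-vanishes = identityʳ-unique S ⟦ N ⟧ (begin
    S + ⟦ N ⟧                   ≈⟨ +-congˡ (sym (sum-replicate N {1#})) ⟩
    S + sum {N} (λ _ → 1#)      ≈⟨ sym (∑-distrib-+ element (λ _ → 1#)) ⟩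
    sum (λ i → element i + 1#)  ≈⟨ sum-reindex +-commutativeMonoid (λ y → y) (λ y≈z → y≈z)
                                     (_+ 1#) (_- 1#) +-congʳ +-congʳ shift-back shift-forth ⟩
    S                           ∎)
    where
    open MonoidSum +-commutativeMonoid using (sum; sum-replicate; ∑-distrib-+)
    S : Carrier
    S = sum element
    shift-back : ∀ y → y + 1# - 1# ≈ y
    shift-back y = trans (+-assoc y 1# (- 1#)) (trans (+-congˡ (-‿inverseʳ 1#)) (+-identityʳ y))
    shift-forth : ∀ y → y - 1# + 1# ≈ y
    shift-forth y = trans (+-assoc y (- 1#) 1#) (trans (+-congˡ (-‿inverseˡ 1#)) (+-identityʳ y))

  nonvanishing : ∀ m r .{{_ : NonZero m}} → N % m ≡ r → ¬ ⟦ r ⟧ ≈ 0# → ¬ ⟦ m ⟧ ≈ 0#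
  nonvanishing m r N%m≡r r≉0 m≈0 =
    r≉0 (trans (reflexive (≡.cong ⟦_⟧ (≡.sym N%m≡r))) (trans (sym (reduce-mod m N m≈0)) order-vanishes))

  -- If N = pⁿ then p = 0 in F, since pⁿ = N = 0 and F has no nilpotents.
  power-order-vanishes : ∀ p n → N ≡ p ^ n → ⟦ p ⟧ ≈ 0#
  power-order-vanishes p n N≡pⁿ =
    pow-zero n (trans (sym (⟦⟧-^ p n)) (trans (reflexive (≡.cong ⟦_⟧ (≡.sym N≡pⁿ))) order-vanishes))

  ifZero : Carrier → Carrier → Carrier → Carrier
  ifZero y u v with y ≟ 0#
  ... | yes _ = u
  ... | no  _ = v

  ifZero-yes : ∀ {y} u v → y ≈ 0# → ifZero y u v ≡ u
  ifZero-yes {y} u v y≈0 with y ≟ 0#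
  ... | yes _   = ≡.refl
  ... | no  y≉0 = ⊥-elim (y≉0 y≈0)

  ifZero-no : ∀ {y} u v → ¬ y ≈ 0# → ifZero y u v ≡ v
  ifZero-no {y} u v y≉0 with y ≟ 0#
  ... | yes y≈0 = ⊥-elim (y≉0 y≈0)
  ... | no  _   = ≡.refl

  unit : Carrier → Carrier
  unit y = ifZero y 1# y

  unit-nonzero : ∀ y → ¬ unit y ≈ 0#
  unit-nonzero y with y ≟ 0#
  ... | yes _   = 1≉0
  ... | no  y≉0 = y≉0

  unit-cong : ∀ {y z} → y ≈ z → unit y ≈ unit z
  unit-cong {y} {z} y≈z with y ≟ 0#
  ... | yes y≈0 = reflexive (≡.sym (ifZero-yes 1# z (trans (sym y≈z) y≈0)))
  ... | no  y≉0 = trans y≈z (reflexive (≡.sym (ifZero-no 1# z (λ z≈0 → y≉0 (trans y≈z z≈0)))))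

  unit-scale : ∀ {a} → ¬ a ≈ 0# → ∀ y → unit (a * y) * ifZero y a 1# ≈ a * unit y
  unit-scale {a} a≉0 y with y ≟ 0#
  ... | yes y≈0 = begin
    unit (a * y) * a  ≡⟨ ≡.cong (_* a) (ifZero-yes 1# (a * y) (trans (*-congˡ y≈0) (zeroʳ a))) ⟩
    1# * a            ≈⟨ *-comm 1# a ⟩
    a * 1#            ∎
  ... | no  y≉0 = begin
    unit (a * y) * 1# ≡⟨ ≡.cong (_* 1#) (ifZero-no 1# (a * y) (λ ay≈0 → y≉0 (zero-product a≉0 ay≈0))) ⟩
    a * y * 1#        ≈⟨ *-identityʳ (a * y) ⟩
    a * y             ∎

  open MonoidSum *-commutativeMonoid using () renaming (sum to ∏)

  product-nonzero : ∀ {n} (f : Fin n → Carrier) → (∀ i → ¬ f i ≈ 0#) → ¬ ∏ f ≈ 0#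
  product-nonzero {zero}  f nz = 1≉0
  product-nonzero {suc n} f nz ∏f≈0 = product-nonzero (λ i → f (suc i)) (λ i → nz (suc i)) (zero-product (nz zero) ∏f≈0)

  -- Fermat's little theorem for a ≉ 0. The product P of the unit parts of all
  -- elements is unchanged by the bijection y ↦ a y; on the other hand,
  -- factor by factor, unit(a y) · δ(y) = a · unit(y) with a correction δ(y)
  -- that is a at y = 0 and 1 elsewhere. Comparing products gives P a = aᴺ P.
  fermat-nonzero : ∀ {a} → ¬ a ≈ 0# → a ↑ N ≈ a
  fermat-nonzero {a} a≉0 with inverse a a≉0
  ... | w , aw≈1 = sym (cancelˡ P≉0 (begin
    P * a               ≈⟨ *-cong (sym scaled-units) (sym correction) ⟩
    ∏ uₐ * ∏ δ          ≈⟨ sym (∑-distrib-+ uₐ δ) ⟩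
    ∏ (λ i → uₐ i * δ i) ≈⟨ sum-cong-≋ {N} (λ i → unit-scale a≉0 (element i)) ⟩
    ∏ (λ i → a * u i)   ≈⟨ ∑-distrib-+ (λ _ → a) u ⟩
    ∏ {N} (λ _ → a) * P ≈⟨ *-congʳ (sum-replicate N {a}) ⟩
    a ↑ N * P           ≈⟨ *-comm (a ↑ N) P ⟩
    P * a ↑ N           ∎))
    where
    open MonoidSum *-commutativeMonoid using (sum-replicate; sum-cong-≋; ∑-distrib-+)
    u uₐ δ : Fin N → Carrier
    u  i = unit (element i)
    uₐ i = unit (a * element i)
    δ  i = ifZero (element i) a 1#
    P : Carrier
    P = ∏ u
    P≉0 : ¬ P ≈ 0#
    P≉0 = product-nonzero u (λ i → unit-nonzero (element i))
    scaled-units : ∏ uₐ ≈ P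
    scaled-units = sum-reindex *-commutativeMonoid unit unit-cong (a *_) (w *_) *-congˡ *-congˡ
      (λ y → trans (sym (*-assoc w a y)) (trans (*-congʳ (trans (*-comm w a) aw≈1)) (*-identityˡ y)))
      (λ y → trans (sym (*-assoc a w y)) (trans (*-congʳ aw≈1) (*-identityˡ y)))
    correction : ∏ δ ≈ a
    correction = trans (sum-single *-commutativeMonoid δ (index 0#) away) (reflexive (ifZero-yes a 1# (element-index 0#)))
      where
      away : ∀ i → i ≢ index 0# → δ i ≈ 1#
      away i i≢ = reflexive (ifZero-no a 1# (λ eᵢ≈0 → i≢ (element-injective (trans eᵢ≈0 (sym (element-index 0#))))))

  -- Fermat's little theorem: aᴺ = a for every a (for a = 0 because N ≥ 1).
  fermat : ∀ a → a ↑ N ≈ a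
  fermat a with a ≟ 0#
  ... | yes a≈0 = trans (^-congˡ N a≈0) (trans (zero↑ N (index 0#)) (sym a≈0))
    where
    zero↑ : ∀ n → Fin n → 0# ↑ n ≈ 0#
    zero↑ (suc n) _ = zeroˡ (0# ↑ n)
  ... | no a≉0 = fermat-nonzero a≉0

  -- If N ≡ 2 (mod 3), say N = 2 + 3k, then x = (x³)^(1+2k): indeed
  -- 3(1 + 2k) = N + (N - 1) and x^N = x. Hence cubing is injective on F.
  cube-root : ∀ k → N ≡ 2 ℕ.+ k ℕ.* 3 → ∀ x → (x ↑ 3) ↑ (1 ℕ.+ 2 ℕ.* k) ≈ x
  cube-root k N≡2+3k x = begin
    (x ↑ 3) ↑ (1 ℕ.+ 2 ℕ.* k)          ≈⟨ ^-assocʳ x 3 (1 ℕ.+ 2 ℕ.* k) ⟩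
    x ↑ (3 ℕ.* (1 ℕ.+ 2 ℕ.* k))        ≡⟨ ≡.cong (x ↑_) exponent ⟩
    x ↑ (N ℕ.+ (1 ℕ.+ k ℕ.* 3))        ≈⟨ ^-homo-* x N (1 ℕ.+ k ℕ.* 3) ⟩
    x ↑ N * x ↑ (1 ℕ.+ k ℕ.* 3)        ≈⟨ *-congʳ (fermat x) ⟩
    x ↑ (2 ℕ.+ k ℕ.* 3)                ≡⟨ ≡.cong (x ↑_) (≡.sym N≡2+3k) ⟩
    x ↑ N                              ≈⟨ fermat x ⟩
    x                                  ∎
    where
    exponent : 3 ℕ.* (1 ℕ.+ 2 ℕ.* k) ≡ N ℕ.+ (1 ℕ.+ k ℕ.* 3)
    exponent = ≡.trans (cube-exponent k) (≡.cong (ℕ._+ (1 ℕ.+ k ℕ.* 3)) (≡.sym N≡2+3k))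

  cube-injective : N % 3 ≡ 2 → ∀ {x y} → x * x * x ≈ y * y * y → x ≈ y
  cube-injective N%3≡2 {x} {y} x³≈y³ = begin
    x                         ≈⟨ sym (cube-root k N≡2+3k x) ⟩
    (x ↑ 3) ↑ (1 ℕ.+ 2 ℕ.* k) ≈⟨ ^-congˡ (1 ℕ.+ 2 ℕ.* k) (trans (cube-as-pow x) (trans x³≈y³ (sym (cube-as-pow y)))) ⟩
    (y ↑ 3) ↑ (1 ℕ.+ 2 ℕ.* k) ≈⟨ cube-root k N≡2+3k y ⟩
    y                         ∎
    where
    k : ℕ
    k = N ℕ./ 3
    N≡2+3k : N ≡ 2 ℕ.+ k ℕ.* 3
    N≡2+3k = ≡.trans (m≡m%n+[m/n]*n N 3) (≡.cong (ℕ._+ k ℕ.* 3) N%3≡2)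

  -- Monic polynomials of degree d, given by their lower coefficients.
  evalMonic : ∀ {d} → Vec Carrier d → Carrier → Carrier
  evalMonic []       z = 1#
  evalMonic (c ∷ cs) z = c + z * evalMonic cs z

  -- Factor theorem p(z) = (z - r) p'(z) + p(r), stated without subtraction.
  factor : ∀ {d} (p : Vec Carrier (suc d)) r → Σ (Vec Carrier d) λ p' →
           ∀ z → evalMonic p z + r * evalMonic p' z ≈ z * evalMonic p' z + evalMonic p r
  factor {zero} (c ∷ []) r = [] , solve 3 (λ c r z → c :+ z :* con 1 :+ r :* con 1 := z :* con 1 :+ (c :+ r :* con 1)) refl c r
  factor {suc d} (c ∷ cs) r with factor cs r
  ... | p' , cs≡ = evalMonic cs r ∷ p' , λ z → begin
    c + z * evalMonic cs z + r * (evalMonic cs r + z * evalMonic p' z)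
      ≈⟨ regroup c z r (evalMonic cs z) (evalMonic cs r) (evalMonic p' z) ⟩
    c + r * evalMonic cs r + z * (evalMonic cs z + r * evalMonic p' z)
      ≈⟨ +-congˡ (*-congˡ (cs≡ z)) ⟩
    c + r * evalMonic cs r + z * (z * evalMonic p' z + evalMonic cs r)
      ≈⟨ regroup′ c z r (evalMonic cs r) (evalMonic p' z) ⟩
    z * (evalMonic cs r + z * evalMonic p' z) + (c + r * evalMonic cs r) ∎
    where
    regroup : ∀ c z r E F D → c + z * E + r * (F + z * D) ≈ c + r * F + z * (E + r * D)
    regroup = solve 6 (λ c z r E F D → c :+ z :* E :+ r :* (F :+ z :* D) := c :+ r :* F :+ z :* (E :+ r :* D)) refl
    regroup′ : ∀ c z r F D → c + r * F + z * (z * D + F) ≈ z * (F + z * D) + (c + r * F)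
    regroup′ = solve 5 (λ c z r F D → c :+ r :* F :+ z :* (z :* D :+ F) := z :* (F :+ z :* D) :+ (c :+ r :* F)) refl

  roots-bound : ∀ {d} (p : Vec Carrier d) (r : Fin (suc d) → Carrier) →
                (∀ i → evalMonic p (r i) ≈ 0#) → (∀ i j → r i ≈ r j → i ≡ j) → ⊥
  roots-bound []       r root distinct = 1≉0 (root zero)
  roots-bound (c ∷ cs) r root distinct with factor (c ∷ cs) (r zero)
  ... | p' , p≡ = roots-bound p' (λ i → r (suc i)) root′ (λ i j eq → suc-injective (distinct (suc i) (suc j) eq))
    where
    -- p(rᵢ) = 0 = p(r₀) gives (rᵢ - r₀) p'(rᵢ) = 0, and rᵢ ≉ r₀.
    root′ : ∀ i → evalMonic p' (r (suc i)) ≈ 0#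
    root′ i with evalMonic p' (r (suc i)) ≟ 0#
    ... | yes v≈0 = v≈0
    ... | no  v≉0 = ⊥-elim (0≢1+n (distinct zero (suc i) (cancelˡ v≉0 (begin
      v * r zero                          ≈⟨ *-comm v (r zero) ⟩
      r zero * v                          ≈⟨ sym (+-identityˡ _) ⟩
      0# + r zero * v                     ≈⟨ +-congʳ (sym (root (suc i))) ⟩
      evalMonic (c ∷ cs) rᵢ + r zero * v  ≈⟨ p≡ rᵢ ⟩
      rᵢ * v + evalMonic (c ∷ cs) (r zero) ≈⟨ +-congˡ (root zero) ⟩
      rᵢ * v + 0#                         ≈⟨ +-identityʳ _ ⟩
      rᵢ * v                              ≈⟨ *-comm rᵢ v ⟩
      v * rᵢ                              ∎))))
      where
      rᵢ v : Carrier
      rᵢ = r (suc i)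
      v = evalMonic p' rᵢ

  -- When N ≡ 1 (mod 2) and N ≡ 2 (mod 3): 2 Q(a, b) = 0 forces a = 0.
  -- Indeed 2 ≉ 0 gives Q(a, b) = 0, so a³ = b³ and a = b; then 3a² = Q(a, a) = 0
  -- with 3 ≉ 0.
  Q-doubled-odd : N % 2 ≡ 1 → N % 3 ≡ 2 → ∀ {a b} → Q a b + Q a b ≈ 0# → a ≈ 0#
  Q-doubled-odd N%2≡1 N%3≡2 {a} {b} 2Q≈0 = square-zero (zero-product 3≉0 (begin
    ⟦ 3 ⟧ * (a * a)              ≈⟨ triple (a * a) ⟩
    a * a + a * a + a * a        ≈⟨ +-cong (+-congˡ (*-congˡ a≈b)) (*-cong a≈b a≈b) ⟩
    Q a b                        ≈⟨ Q≈0 ⟩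
    0#                           ∎))
    where
    2≉0 : ¬ ⟦ 2 ⟧ ≈ 0#
    2≉0 = nonvanishing 2 1 N%2≡1 (λ 1≈0 → 1≉0 (trans (sym (+-identityʳ 1#)) 1≈0))
    3≉0 : ¬ ⟦ 3 ⟧ ≈ 0#
    3≉0 = nonvanishing 3 2 N%3≡2 2≉0
    Q≈0 : Q a b ≈ 0#
    Q≈0 = zero-product 2≉0 (trans (double (Q a b)) 2Q≈0)
    a≈b : a ≈ b
    a≈b = cube-injective N%3≡2 (equal-cubes Q≈0)

  -- In characteristic 3: 2 Q(a, b) = 0 forces a = b, because 3 Q = 0 gives
  -- Q(a, b) = 0 and Q(a, b) = (a + 2b)².
  Q-doubled-char-3 : ⟦ 3 ⟧ ≈ 0# → ∀ {a b} → Q a b + Q a b ≈ 0# → a ≈ b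
  Q-doubled-char-3 3≈0 {a} {b} 2Q≈0 = begin
    a                       ≈⟨ sym (trans (+-congˡ (thrice-zero b)) (+-identityʳ a)) ⟩
    a + (b + b + b)         ≈⟨ regroup a b ⟩
    (a + b + b) + b         ≈⟨ +-congʳ a+2b≈0 ⟩
    0# + b                  ≈⟨ +-identityˡ b ⟩
    b                       ∎
    where
    thrice-zero : ∀ y → y + y + y ≈ 0#
    thrice-zero y = trans (sym (triple y)) (trans (*-congʳ 3≈0) (zeroˡ y))
    Q≈0 : Q a b ≈ 0#
    Q≈0 = trans (sym (+-identityˡ _)) (trans (+-congʳ (sym 2Q≈0)) (thrice-zero (Q a b)))
    a+2b≈0 : a + b + b ≈ 0#
    a+2b≈0 = square-zero (begin
      (a + b + b) * (a + b + b)  ≈⟨ shifted-square a b ⟩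
      Q a b + (a * b + b * b + (a * b + b * b) + (a * b + b * b))
                                 ≈⟨ +-cong Q≈0 (thrice-zero (a * b + b * b)) ⟩
      0# + 0#                    ≈⟨ +-identityʳ 0# ⟩
      0#                         ∎)
    regroup : ∀ a b → a + (b + b + b) ≈ a + b + b + b
    regroup = solve 2 (λ a b → a :+ (b :+ b :+ b) := a :+ b :+ b :+ b) refl

module Subfield {c ℓ c' ℓ' M m} (L : FiniteField c ℓ M) (K : FiniteField c' ℓ' (suc (suc m)))
                (ι : FiniteField.Carrier K → FiniteField.Carrier L) (ι-hom : IsFieldEmbedding K L ι) where
  open FiniteField L hiding (zero)
  open FiniteFieldFacts L
  open import Relation.Binary.Reasoning.Setoid setoid
  private
    module Kᴿ = FiniteField K
    module Kᶠ = FiniteFieldFacts K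
    module H  = IsRingHomomorphism ι-hom
    open import Algebra.Properties.Group Kᴿ.+-group using (x∙y⁻¹≈ε⇒x≈y)

  q : ℕ
  q = suc (suc m)

  ι-pow : ∀ y n → ι (y Kᶠ.↑ n) ≈ ι y ↑ n
  ι-pow y zero    = H.1#-homo
  ι-pow y (suc n) = trans (H.*-homo y (y Kᶠ.↑ n)) (*-congˡ (ι-pow y n))

  -- A ring homomorphism out of a field is injective: ι(y - z) = 0 with y - z
  -- invertible would give ι(1) = 0.
  ι-injective : ∀ {y z} → ι y ≈ ι z → y Kᴿ.≈ z
  ι-injective {y} {z} ιy≈ιz with (y Kᴿ.- z) Kᶠ.≟ Kᴿ.0#
  ... | yes y-z≈0 = x∙y⁻¹≈ε⇒x≈y y z y-z≈0
  ... | no  y-z≉0 with Kᶠ.inverse (y Kᴿ.- z) y-z≉0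
  ... | w , [y-z]w≈1 = ⊥-elim (1≉0 (begin
    1#                      ≈⟨ sym H.1#-homo ⟩
    ι Kᴿ.1#                 ≈⟨ H.⟦⟧-cong (Kᴿ.sym [y-z]w≈1) ⟩
    ι ((y Kᴿ.- z) Kᴿ.* w)   ≈⟨ H.*-homo (y Kᴿ.- z) w ⟩
    ι (y Kᴿ.- z) * ι w      ≈⟨ *-congʳ (trans (H.+-homo y (Kᴿ.- z)) (+-cong ιy≈ιz (H.-‿homo z))) ⟩
    (ι z - ι z) * ι w       ≈⟨ *-congʳ (-‿inverseʳ (ι z)) ⟩
    0# * ι w                ≈⟨ zeroˡ (ι w) ⟩
    0#                      ∎))

  -- X^q - X as a monic polynomial of degree q.
  frobenius-poly : Vec Carrier q
  frobenius-poly = 0# ∷ - 1# ∷ replicate m 0#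

  eval-monomial : ∀ n z → evalMonic (replicate n 0#) z ≈ z ↑ n
  eval-monomial zero    z = refl
  eval-monomial (suc n) z = trans (+-identityˡ _) (*-congˡ (eval-monomial n z))

  fixed-point-root : ∀ {z} → z ↑ q ≈ z → evalMonic frobenius-poly z ≈ 0#
  fixed-point-root {z} zᵠ≈z = begin
    0# + z * (- 1# + z * evalMonic (replicate m 0#) z)  ≈⟨ +-identityˡ _ ⟩
    z * (- 1# + z * evalMonic (replicate m 0#) z)       ≈⟨ *-congˡ (+-congˡ (*-congˡ (eval-monomial m z))) ⟩
    z * (- 1# + z ↑ suc m)                              ≈⟨ distribˡ z (- 1#) (z ↑ suc m) ⟩
    z * - 1# + z ↑ q                                    ≈⟨ +-congˡ (trans zᵠ≈z (sym (*-identityʳ z))) ⟩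
    z * - 1# + z * 1#                                   ≈⟨ sym (distribˡ z (- 1#) 1#) ⟩
    z * (- 1# + 1#)                                     ≈⟨ *-congˡ (-‿inverseˡ 1#) ⟩
    z * 0#                                              ≈⟨ zeroʳ z ⟩
    0#                                                  ∎

  -- A fixed point x of x ↦ x^q lies in ι(K): otherwise x and the q elements
  -- of ι(K), all fixed by Fermat's theorem in K, are q + 1 roots of X^q - X.
  fixed-point-in-image : ∀ x → x ↑ q ≈ x → ∃ λ y → ι y ≈ x
  fixed-point-in-image x xᵠ≈x with anyᶠ? (λ i → ι (Kᶠ.element i) ≟ x)
  ... | yes (i , ιyᵢ≈x) = Kᶠ.element i , ιyᵢ≈x
  ... | no  x∉ιK        = ⊥-elim (roots-bound frobenius-poly r root distinct)
    where
    r : Fin (suc q) → Carrier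
    r zero    = x
    r (suc i) = ι (Kᶠ.element i)
    root : ∀ i → evalMonic frobenius-poly (r i) ≈ 0#
    root zero    = fixed-point-root xᵠ≈x
    root (suc i) = fixed-point-root (trans (sym (ι-pow _ q)) (H.⟦⟧-cong (Kᶠ.fermat _)))
    distinct : ∀ i j → r i ≈ r j → i ≡ j
    distinct zero    zero    _      = ≡.refl
    distinct zero    (suc j) x≈ιyⱼ = ⊥-elim (x∉ιK (j , sym x≈ιyⱼ))
    distinct (suc i) zero    ιyᵢ≈x = ⊥-elim (x∉ιK (i , ιyᵢ≈x))
    distinct (suc i) (suc j) ιyᵢ≈ιyⱼ = ≡.cong suc (Kᶠ.element-injective (ι-injective ιyᵢ≈ιyⱼ))

module _ {c ℓ} (q : ℕ) (L : FiniteField c ℓ (q ^ 3)) where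
  open FiniteField L
  open FiniteFieldFacts L
  open import Algebra.Properties.CommutativeSemiring.Exp commutativeSemiring using (^-distrib-*)

  -- T(x) = T(x²) = 0 says that the conjugates x, x^q, x^(q²) have vanishing
  -- first and second power sums; hence 2 Q(x, x^q) = 0.
  trace-conditions : ∀ x → Tr q L x ≈ 0# → Tr q L (x * x) ≈ 0# → Q x (x ↑ q) + Q x (x ↑ q) ≈ 0#
  trace-conditions x Tx≈0 Tx²≈0 = power-sums Tx≈0
    (trans (sym (+-cong (+-congˡ (^-distrib-* x x q)) (^-distrib-* x x (q ^ 2)))) Tx²≈0)

mainTheorem11 : ∀ {c ℓ c' ℓ'} (q : ℕ) → IsPrimePower q → q % 4 ≡ 1 → q % 3 ≢ 1
                  → (L : FiniteField c ℓ (q ^ 3)) (x : FiniteField.Carrier L)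
                  → FiniteField._≈_ L (Tr q L x) (FiniteField.0# L)
                  → FiniteField._≈_ L (Tr q L (FiniteField._*_ L x x)) (FiniteField.0# L)
                  → (q % 6 ≡ 5 → FiniteField._≈_ L x (FiniteField.0# L))
                    × (∀ (h : ℕ) → q ≡ 3 ^ h
                       → (K : FiniteField c' ℓ' q) (ι : FiniteField.Carrier K → FiniteField.Carrier L)
                       → IsFieldEmbedding K L ι
                       → ∃ λ y → FiniteField._≈_ L (ι y) x)
-- q = 0 and q = 1 are excluded by q ≡ 1 (mod 4) and q ≢ 1 (mod 3).
mainTheorem11 zero          _ ()
mainTheorem11 (suc zero)    _ _ q%3≢1 = ⊥-elim (q%3≢1 ≡.refl)
mainTheorem11 {c' = c'} {ℓ' = ℓ'} q@(suc (suc m)) _ _ _ L x Tx≈0 Tx²≈0 = part-i , part-ii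
  where
  open FiniteField L using (Carrier; _≈_; _+_; 0#; sym)
  open FiniteFieldFacts L using (Q; _↑_; Q-doubled-odd; Q-doubled-char-3; power-order-vanishes)

  2Q≈0 : Q x (x ↑ q) + Q x (x ↑ q) ≈ 0#
  2Q≈0 = trace-conditions q L x Tx≈0 Tx²≈0

  -- (i) q³ is odd and ≡ 2 (mod 3).
  part-i : q % 6 ≡ 5 → x ≈ 0#
  part-i q%6≡5 = Q-doubled-odd (proj₁ (cube-residues q q%6≡5)) (proj₂ (cube-residues q q%6≡5)) 2Q≈0

  -- (ii) L has order 3^(3h), so 3 = 0 in L and x^q = x.
  part-ii : ∀ h → q ≡ 3 ^ h → (K : FiniteField c' ℓ' q) (ι : FiniteField.Carrier K → Carrier)
            → IsFieldEmbedding K L ι → ∃ λ y → ι y ≈ x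
  part-ii h q≡3ʰ K ι ι-hom =
    Subfield.fixed-point-in-image L K ι ι-hom x (sym (Q-doubled-char-3 (power-order-vanishes 3 (h ℕ.* 3) order≡) 2Q≈0))
    where
    order≡ : q ^ 3 ≡ 3 ^ (h ℕ.* 3)
    order≡ = ≡.trans (≡.cong (_^ 3) q≡3ʰ) (ℕₚ.^-*-assoc 3 h 3)
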